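{- Let $G=(V,E)$ be a $2$-edge-connected undirected unweighted graph and let $T$ be a spanning tree of $G$. For every edge $e$ of $T$ there exists a set $C\subseteq S_e$ with $|C|\le 6$ that is critical for $e$, i.e., for every swap edge $f\in S_e$, $C$ contains an edge that is critical for $f$.
   Context: $d_T(u,v)$ denotes the number of edges on the path between $u$ and $v$ in $T$. For an edge $e$ of $T$, let $X$ and $Y$ be the vertex sets of the two connected components of $T-e$, and let $S_e$ be the set of swap edges of $e$: the edges of $E\setminus\{e\}$ with one endpoint in $X$ and the other in $Y$. Every swap edge is written $(u,v)$ with $u\in X$, $v\in Y$. For $f\in S_e$, $T_{e/f}$ is the tree obtained from $T$ by replacing $e$ with $f$. For $f=(x,y)\in S_e$ ($x\in X$, $y\in Y$), an edge $g=(a,b)\in S_e$ ($a\in X$, $b\in Y$) is called critical for $f$ if $\sigma_S(T_{e/f})=d_T(x,a)+1+d_T(b,y)$, where $\sigma_S(T_{e/f})=\max_{(a',b')\in S_e} d_{T_{e/f}}(a',b')/d_{G-e}(a',b')=\max_{(a',b')\in S_e}\big(d_T(x,a')+1+d_T(b',y)\big)$ is the stretch factor of $T_{e/f}$ with respect to $G-e$ restricted to the endpoint pairs of swap edges of $e$; equivalently, $g$ is critical for $f$ if it maximizes $d_T(x,a)+1+d_T(b,y)$ over $g=(a,b)\in S_e$. -}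

module Defs where

open import Data.Nat using (ℕ; zero; suc; _+_; _≤_)
open import Data.Fin using (Fin)
open import Data.Bool using (Bool; true; false)
open import Data.Product using (Σ; ∃; _×_; _,_)
open import Data.Sum using (_⊎_)
open import Relation.Binary.PropositionalEquality using (_≡_)
open import Relation.Nullary using (¬_)

private variable n : ℕ

VRel : ℕ → Set₁
VRel n = Fin n → Fin n → Set

Graph : ℕ → Set
Graph n = Fin n → Fin n → Bool

Adj : Graph n → VRel n
Adj G u v = G u v ≡ true

SimpleGraph : Graph n → Set
SimpleGraph {n} G = ((u v : Fin n) → G u v ≡ G v u) × ((u : Fin n) → G u u ≡ false)

data Walk {n : ℕ} (R : VRel n) : Fin n → Fin n → ℕ → Set where
  [] : ∀ {u} → Walk R u u 0
  _∷_ : ∀ {u v w k} → R u v → Walk R v w k → Walk R u w (suc k)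

Reach : VRel n → VRel n
Reach R u v = ∃ λ k → Walk R u v k

Connected : VRel n → Set
Connected {n} R = (u v : Fin n) → Reach R u v

Without : VRel n → Fin n → Fin n → VRel n
Without R p q u v = R u v × ¬ ((u ≡ p × v ≡ q) ⊎ (u ≡ q × v ≡ p))

TwoEdgeConnected : Graph n → Set
TwoEdgeConnected {n} G =
  Connected (Adj G) × ((p q : Fin n) → Adj G p q → Connected (Without (Adj G) p q))

Subgraph : Graph n → Graph n → Set
Subgraph {n} T G = (u v : Fin n) → Adj T u v → Adj G u v

-- Tree: simple, connected, acyclic (every edge is a bridge, i.e. lies on no cycle).
IsTree : Graph n → Set
IsTree {n} T = SimpleGraph T × Connected (Adj T) ×
  ((p q : Fin n) → Adj T p q → ¬ Reach (Without (Adj T) p q) p q)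

-- Spanning tree of G (all vertices Fin n are vertices of T).
SpanningTree : Graph n → Graph n → Set
SpanningTree T G = Subgraph T G × IsTree T

Dist : VRel n → Fin n → Fin n → ℕ → Set
Dist R u v k = Walk R u v k × ((m : ℕ) → Walk R u v m → k ≤ m)

-- Swap edges of the tree edge e = (p,q), oriented as (u,v) with u ∈ X (side of p
-- in T - e) and v ∈ Y (side of q in T - e), and (u,v) ≠ e.
Swap : Graph n → Graph n → Fin n → Fin n → Fin n × Fin n → Set
Swap G T p q (u , v) =
  Reach (Without (Adj T) p q) p u × Reach (Without (Adj T) p q) q v ×
  Adj G u v × ¬ (u ≡ p × v ≡ q)

Critical : Graph n → Graph n → Fin n → Fin n → Fin n × Fin n → Fin n × Fin n → Set
Critical {n} G T p q (x , y) (a , b) =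
  (a' b' : Fin n) → Swap G T p q (a' , b') →
  (d₁ d₂ d₁' d₂' : ℕ) →
  Dist (Adj T) x a d₁ → Dist (Adj T) b y d₂ →
  Dist (Adj T) x a' d₁' → Dist (Adj T) b' y d₂' →
  d₁' + 1 + d₂' ≤ d₁ + 1 + d₂

{-# OPTIONS --safe #-}

-- The tree metric d = d_T satisfies the four-point condition
-- d(x,y) + d(z,w) ≤ max (d(x,z) + d(y,w)) (d(x,w) + d(y,z)); by induction on d(x,y),
-- cutting T at the first edge of a geodesic from x to y.
-- A swap edge g = (a,b) is critical for f = (x,y) exactly when it maximises
-- E(f,g) = d(x,a) + d(y,b) over S_e. Let (g₁,g₂) maximise E on S_e × S_e, and let g₃, g₄
-- maximise E(·, g₁ ⋈ g₂) and E(·, g₂ ⋈ g₁), where (a,b) ⋈ (a',b') = (a,b'). Applying the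
-- four-point condition in each coordinate of E(f,g) + E(g₁,g₂), and once more to the crossed
-- terms, bounds E(f,g) by E(f,gᵢ) for some i; so the member of {g₁,…,g₄} farthest from f
-- is critical for f.
module Submission where

open import Defs
open import Data.Nat using (ℕ; zero; suc; _+_; _≤_; _<_; z≤n; s≤s; s≤s⁻¹)
open import Data.Nat.Properties
open import Data.Nat.Induction using (<-rec)
open import Data.Fin using (Fin)
open import Data.Fin.Properties using (any?) renaming (_≟_ to _≟ᶠ_)
open import Data.Bool using (true)
open import Data.Bool.Properties using () renaming (_≟_ to _≟ᵇ_)
open import Data.Product using (Σ; ∃; _×_; _,_; proj₁; proj₂; uncurry)
open import Data.Sum using (_⊎_; inj₁; inj₂) renaming (map to ⊎-map)
open import Data.Empty using (⊥; ⊥-elim)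
open import Data.List using (List; []; _∷_; length; filter; cartesianProduct; allFin)
open import Data.List.Membership.Propositional using (_∈_)
open import Data.List.Membership.Propositional.Properties
  using (∈-filter⁺; ∈-filter⁻; ∈-cartesianProduct⁺; ∈-cartesianProduct⁻; ∈-allFin)
open import Data.List.Relation.Unary.Any using (here; there)
import Data.List.Relation.Unary.All as All
open import Data.List.Extrema.Nat using (argmax; argmax-all; f[⊥]≤f[argmax]; f[xs]≤f[argmax])
open import Relation.Nullary using (¬_; Dec; yes; no)
open import Relation.Nullary.Decidable using (_×-dec_; _⊎-dec_; ¬?; map′)
open import Relation.Unary using (Decidable)
open import Relation.Binary.PropositionalEquality
open import Algebra.Properties.CommutativeSemigroup +-commutativeSemigroup using (interchange; x∙yz≈yx∙z)

private variable n : ℕ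

least-witness : ∀ {P : ℕ → Set} → Decidable P → ∀ k → P k →
                Σ ℕ λ m → P m × (∀ j → P j → m ≤ j)
least-witness {P} P? = <-rec _ search
  where
  Least : Set
  Least = Σ ℕ λ m → P m × (∀ j → P j → m ≤ j)

  search : ∀ k → (∀ {j} → j < k → P j → Least) → P k → Least
  search k below pk with anyUpTo? P? k
  ... | yes (j , j<k , pj) = below j<k pj
  ... | no none = k , pk , λ j pj → ≮⇒≥ λ j<k → none (j , j<k , pj)

-- Opaque so that no type below unfolds argmax, whose normal forms grow exponentially.
opaque
  maximiser : ∀ {A : Set} (φ : A → ℕ) {xs : List A} {y : A} → y ∈ xs →
              Σ A λ m → m ∈ xs × (∀ z → z ∈ xs → φ z ≤ φ m)
  maximiser φ {x ∷ xs} _ =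
    argmax φ x xs ,
    argmax-all φ (here refl) (All.tabulate there) ,
    λ { z (here refl) → f[⊥]≤f[argmax] {f = φ} x xs
      ; z (there z∈xs) → All.lookup (f[xs]≤f[argmax] {f = φ} x xs) z∈xs }

_++ʷ_ : ∀ {R : VRel n} {u v w k m} → Walk R u v k → Walk R v w m → Walk R u w (k + m)
[] ++ʷ w = w
(r ∷ w₁) ++ʷ w₂ = r ∷ (w₁ ++ʷ w₂)

reverseʷ : ∀ {R : VRel n} → (∀ {u v} → R u v → R v u) →
           ∀ {u v k} → Walk R u v k → Walk R v u k
reverseʷ R-sym [] = []
reverseʷ {R = R} R-sym {v = v} (_∷_ {k = k} r w) =
  subst (Walk R v _) (+-comm k 1) (reverseʷ R-sym w ++ʷ (R-sym r ∷ []))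

walk-zero⇒≡ : ∀ {R : VRel n} {u v} → Walk R u v 0 → u ≡ v
walk-zero⇒≡ [] = refl

walk? : ∀ {R : VRel n} → (∀ u v → Dec (R u v)) → ∀ k u v → Dec (Walk R u v k)
walk? R? zero u v = map′ (λ { refl → [] }) walk-zero⇒≡ (u ≟ᶠ v)
walk? R? (suc k) u v =
  map′ (λ (_ , r , w) → r ∷ w) (λ { (r ∷ w) → _ , r , w })
       (any? λ x → R? u x ×-dec walk? R? k x v)

shortest : ∀ {R : VRel n} → (∀ u v → Dec (R u v)) → ∀ {u v} → Reach R u v → Σ ℕ (Dist R u v)
shortest R? {u} {v} (k , w) = least-witness (λ j → walk? R? j u v) k w

FourPointAt : {V : Set} → (V → V → ℕ) → V → V → Set
FourPointAt d x y = ∀ z w → d x y + d z w ≤ d x z + d y w ⊎ d x y + d z w ≤ d x w + d y z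

FourPoint : {V : Set} → (V → V → ℕ) → Set
FourPoint d = ∀ x y → FourPointAt d x y

enumerate : ∀ {P : Fin n × Fin n → Set} → Decidable P →
            Σ (List (Fin n × Fin n)) λ L → (∀ g → g ∈ L → P g) × (∀ g → P g → g ∈ L)
enumerate {n} P? =
  filter P? pairs ,
  (λ g g∈L → proj₂ (∈-filter⁻ P? {xs = pairs} g∈L)) ,
  λ (u , v) Pg → ∈-filter⁺ P? (∈-cartesianProduct⁺ (∈-allFin u) (∈-allFin v)) Pg
  where
  pairs : List (Fin n × Fin n)
  pairs = cartesianProduct (allFin n) (allFin n)

module PairMetric {V : Set} (d : V → V → ℕ) (d-sym : ∀ u v → d u v ≡ d v u)
  (four-point : FourPoint d) where

  Pair : Set
  Pair = V × V

  E : Pair → Pair → ℕ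
  E (x , y) (a , b) = d x a + d y b

  _⋈_ : Pair → Pair → Pair
  (a , _) ⋈ (_ , b) = a , b

  E-⋈ : ∀ h k → E (h ⋈ k) (k ⋈ h) ≡ E h k
  E-⋈ (a , b) (a' , b') = cong (d a a' +_) (d-sym b' b)

  add-coordinates : ∀ {x a s t c e h y b s' t' c' e' h'} →
    d x a + d s t ≤ d x c + d e h → d y b + d s' t' ≤ d y c' + d e' h' →
    E (x , y) (a , b) + E (s , s') (t , t') ≤ E (x , y) (c , c') + E (e , e') (h , h')
  add-coordinates {x} {a} {s} {t} {c} {e} {h} {y} {b} {s'} {t'} {c'} {e'} {h'} le le' =
    subst₂ _≤_ (interchange (d x a) (d s t) (d y b) (d s' t'))
               (interchange (d x c) (d e h) (d y c') (d e' h'))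
               (+-mono-≤ le le')

  exchange : ∀ f g h k →
    E f g + E h k ≤ E f h + E g k ⊎ E f g + E h k ≤ E f k + E g h ⊎
    E f g + E h k ≤ E f (h ⋈ k) + E g (k ⋈ h) ⊎ E f g + E h k ≤ E f (k ⋈ h) + E g (h ⋈ k)
  exchange (x , y) (a , b) (s , s') (t , t') with four-point x a s t | four-point y b s' t'
  ... | inj₁ le | inj₁ le' = inj₁ (add-coordinates le le')
  ... | inj₂ le | inj₂ le' = inj₂ (inj₁ (add-coordinates le le'))
  ... | inj₁ le | inj₂ le' = inj₂ (inj₂ (inj₁ (add-coordinates le le')))
  ... | inj₂ le | inj₁ le' = inj₂ (inj₂ (inj₂ (add-coordinates le le')))

  exchange-⋈ : ∀ f h k l →
    E f (h ⋈ k) + E l (k ⋈ h) ≤ E f l + E h k ⊎ E f (h ⋈ k) + E l (k ⋈ h) ≤ E f k + E h l ⊎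
    E f (h ⋈ k) + E l (k ⋈ h) ≤ E f h + E l k
  exchange-⋈ f@(x , y) h@(a₁ , b₁) k@(a₂ , b₂) l@(a₃ , b₃)
    with four-point x a₁ a₃ a₂ | four-point y b₂ b₃ b₁
  ... | inj₁ le | inj₁ le' =
    inj₁ (≤-trans (add-coordinates le le') (≤-reflexive (cong (E f l +_) (E-⋈ h k))))
  ... | inj₂ le | _ =
    inj₂ (inj₁ (≤-trans (add-coordinates le ≤-refl) (≤-reflexive (cong (E f k +_) (E-⋈ h l)))))
  ... | inj₁ _ | inj₂ le' =
    inj₂ (inj₂ (≤-trans (add-coordinates ≤-refl le') (≤-reflexive (cong (E f h +_) (E-⋈ l k)))))

  module Candidates (L : List Pair) (g₁ g₂ g₃ g₄ : Pair)
    (g₁∈L : g₁ ∈ L) (g₂∈L : g₂ ∈ L) (g₃∈L : g₃ ∈ L) (g₄∈L : g₄ ∈ L)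
    (g₁g₂-max : ∀ {h h'} → h ∈ L → h' ∈ L → E h h' ≤ E g₁ g₂)
    (g₃-max : ∀ h → h ∈ L → E h (g₁ ⋈ g₂) ≤ E g₃ (g₁ ⋈ g₂))
    (g₄-max : ∀ h → h ∈ L → E h (g₂ ⋈ g₁) ≤ E g₄ (g₂ ⋈ g₁)) where

    C : List Pair
    C = g₁ ∷ g₂ ∷ g₃ ∷ g₄ ∷ []

    C⊆L : ∀ c → c ∈ C → c ∈ L
    C⊆L _ (here refl) = g₁∈L
    C⊆L _ (there (here refl)) = g₂∈L
    C⊆L _ (there (there (here refl))) = g₃∈L
    C⊆L _ (there (there (there (here refl)))) = g₄∈L

    Dominated : Pair → Pair → Set
    Dominated f g = ∃ λ c → c ∈ C × E f g ≤ E f c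

    dominated-by : ∀ {f g c h h'} → c ∈ C → h ∈ L → h' ∈ L →
                   E f g + E g₁ g₂ ≤ E f c + E h h' → Dominated f g
    dominated-by {f} {g} {c} c∈C h∈L h'∈L le = c , c∈C ,
      +-cancelʳ-≤ (E g₁ g₂) (E f g) (E f c) (≤-trans le (+-monoʳ-≤ (E f c) (g₁g₂-max h∈L h'∈L)))

    dominated-via-g₃ : ∀ {f g} → E f g + E g₁ g₂ ≤ E f (g₂ ⋈ g₁) + E g₃ (g₁ ⋈ g₂) → Dominated f g
    dominated-via-g₃ {f} le with exchange-⋈ f g₂ g₁ g₃
    ... | inj₁ le' = dominated-by (there (there (here refl))) g₂∈L g₁∈L (≤-trans le le')
    ... | inj₂ (inj₁ le') = dominated-by (here refl) g₂∈L g₃∈L (≤-trans le le')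
    ... | inj₂ (inj₂ le') = dominated-by (there (here refl)) g₃∈L g₁∈L (≤-trans le le')

    dominated-via-g₄ : ∀ {f g} → E f g + E g₁ g₂ ≤ E f (g₁ ⋈ g₂) + E g₄ (g₂ ⋈ g₁) → Dominated f g
    dominated-via-g₄ {f} le with exchange-⋈ f g₁ g₂ g₄
    ... | inj₁ le' = dominated-by (there (there (there (here refl)))) g₁∈L g₂∈L (≤-trans le le')
    ... | inj₂ (inj₁ le') = dominated-by (there (here refl)) g₁∈L g₄∈L (≤-trans le le')
    ... | inj₂ (inj₂ le') = dominated-by (here refl) g₄∈L g₂∈L (≤-trans le le')

    dominated : ∀ f {g} → g ∈ L → Dominated f g
    dominated f {g} g∈L with exchange f g g₁ g₂
    ... | inj₁ le = dominated-by (here refl) g∈L g₂∈L le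
    ... | inj₂ (inj₁ le) = dominated-by (there (here refl)) g∈L g₁∈L le
    ... | inj₂ (inj₂ (inj₁ le)) =
      dominated-via-g₄ (≤-trans le (+-monoʳ-≤ (E f (g₁ ⋈ g₂)) (g₄-max g g∈L)))
    ... | inj₂ (inj₂ (inj₂ le)) =
      dominated-via-g₃ (≤-trans le (+-monoʳ-≤ (E f (g₂ ⋈ g₁)) (g₃-max g g∈L)))

    farthest : ∀ f → ∃ λ c → c ∈ C × (∀ g → g ∈ L → E f g ≤ E f c)
    farthest f with maximiser (E f) {C} (here refl)
    ... | c , c∈C , c-max = c , c∈C , λ g g∈L →
      let (c' , c'∈C , g≤c') = dominated f g∈L in ≤-trans g≤c' (c-max c' c'∈C)

  FarthestAmongFour : List Pair → Set
  FarthestAmongFour L = Σ (List Pair) λ C →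
    length C ≤ 4 × (∀ c → c ∈ C → c ∈ L) ×
    (∀ f {g} → g ∈ L → ∃ λ c → c ∈ C × (∀ g' → g' ∈ L → E f g' ≤ E f c))

  farthest-among-four-nonempty : ∀ L {g₀} → g₀ ∈ L → FarthestAmongFour L
  farthest-among-four-nonempty L g₀∈L
    with maximiser (uncurry E) (∈-cartesianProduct⁺ g₀∈L g₀∈L)
  ... | (g₁ , g₂) , g₁g₂∈L² , g₁g₂-max
    with maximiser (λ h → E h (g₁ ⋈ g₂)) g₀∈L | maximiser (λ h → E h (g₂ ⋈ g₁)) g₀∈L
  ... | g₃ , g₃∈L , g₃-max | g₄ , g₄∈L , g₄-max =
    C , ≤-refl , C⊆L , λ f _ → farthest f
    where
    open Candidates L g₁ g₂ g₃ g₄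
      (proj₁ (∈-cartesianProduct⁻ L L g₁g₂∈L²)) (proj₂ (∈-cartesianProduct⁻ L L g₁g₂∈L²))
      g₃∈L g₄∈L (λ h∈L h'∈L → g₁g₂-max _ (∈-cartesianProduct⁺ h∈L h'∈L)) g₃-max g₄-max

  farthest-among-four : ∀ L → FarthestAmongFour L
  farthest-among-four [] = [] , z≤n , (λ _ ()) , λ _ ()
  farthest-among-four (g ∷ gs) = farthest-among-four-nonempty (g ∷ gs) (here refl)

module TreeMetric (T : Graph n) (T-sym : ∀ u v → T u v ≡ T v u) (connected : Connected (Adj T))
  (bridge : ∀ p q → Adj T p q → ¬ Reach (Without (Adj T) p q) p q) where

  adj? : ∀ u v → Dec (Adj T u v)
  adj? u v = T u v ≟ᵇ true

  adj-sym : ∀ {u v} → Adj T u v → Adj T v u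
  adj-sym {u} {v} r = trans (T-sym v u) r

  geodesic : ∀ u v → Σ ℕ (Dist (Adj T) u v)
  geodesic u v = shortest adj? (connected u v)

  d : Fin n → Fin n → ℕ
  d u v = proj₁ (geodesic u v)

  geodesic-walk : ∀ u v → Walk (Adj T) u v (d u v)
  geodesic-walk u v = proj₁ (proj₂ (geodesic u v))

  d-minimal : ∀ {u v m} → Walk (Adj T) u v m → d u v ≤ m
  d-minimal {u} {v} = proj₂ (proj₂ (geodesic u v)) _

  Dist⇒≡d : ∀ {u v k} → Dist (Adj T) u v k → k ≡ d u v
  Dist⇒≡d {u} {v} (w , k-minimal) = ≤-antisym (k-minimal _ (geodesic-walk u v)) (d-minimal w)

  d-refl : ∀ u → d u u ≡ 0
  d-refl u = n≤0⇒n≡0 (d-minimal [])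

  d≡0⇒≡ : ∀ {u v} → d u v ≡ 0 → u ≡ v
  d≡0⇒≡ {u} {v} e = walk-zero⇒≡ (subst (Walk (Adj T) u v) e (geodesic-walk u v))

  d-sym : ∀ u v → d u v ≡ d v u
  d-sym u v = ≤-antisym (d-minimal (reverseʷ adj-sym (geodesic-walk v u)))
                        (d-minimal (reverseʷ adj-sym (geodesic-walk u v)))

  d-triangle : ∀ u v w → d u w ≤ d u v + d v w
  d-triangle u v w = d-minimal (geodesic-walk u v ++ʷ geodesic-walk v w)

  d-adjacent : ∀ {u v} w → Adj T u v → d u w ≤ suc (d v w)
  d-adjacent {v = v} w r = d-minimal (r ∷ geodesic-walk v w)

  next-hop : ∀ {x y k} → d x y ≡ suc k → Σ (Fin n) λ x' → Adj T x x' × d x' y ≡ k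
  next-hop {x} {y} {k} e with subst (Walk (Adj T) x y) e (geodesic-walk x y)
  ... | _∷_ {v = x'} r w =
    x' , r , ≤-antisym (d-minimal w) (s≤s⁻¹ (subst (_≤ suc (d x' y)) e (d-adjacent y r)))

  module Cut (p q : Fin n) (pq : Adj T p q) where

    T-e : VRel n
    T-e = Without (Adj T) p q

    X Y : Fin n → Set
    X = Reach T-e p
    Y = Reach T-e q

    T-e-sym : ∀ {u v} → T-e u v → T-e v u
    T-e-sym (r , ¬e) = adj-sym r , λ { (inj₁ (u≡p , v≡q)) → ¬e (inj₂ (v≡q , u≡p))
                                     ; (inj₂ (u≡q , v≡p)) → ¬e (inj₁ (v≡p , u≡q)) }

    extend : ∀ {s u v} → Reach T-e s u → T-e u v → Reach T-e s v
    extend (k , w) r = k + 1 , (w ++ʷ (r ∷ []))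

    sides-disjoint : ∀ {u} → X u → Y u → ⊥
    sides-disjoint (k , w) (m , w') = bridge p q pq (k + m , (w ++ʷ reverseʷ T-e-sym w'))

    is-e? : ∀ u v → Dec ((u ≡ p × v ≡ q) ⊎ (u ≡ q × v ≡ p))
    is-e? u v = (u ≟ᶠ p ×-dec v ≟ᶠ q) ⊎-dec (u ≟ᶠ q ×-dec v ≟ᶠ p)

    side-along : ∀ {u v k} → Walk (Adj T) u v k → X u ⊎ Y u → X v ⊎ Y v
    side-along [] s = s
    side-along {u} (_∷_ {v = v} r w) s with is-e? u v
    ... | yes (inj₁ (_ , refl)) = side-along w (inj₂ (0 , []))
    ... | yes (inj₂ (_ , refl)) = side-along w (inj₁ (0 , []))
    ... | no ¬e = side-along w (⊎-map (λ x → extend x (r , ¬e)) (λ y → extend y (r , ¬e)) s)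

    sides-cover : ∀ u → X u ⊎ Y u
    sides-cover u = side-along (proj₂ (connected p u)) (inj₁ (0 , []))

    crossing : ∀ {c v m} → X c → Y v → Walk (Adj T) c v m →
               Σ ℕ λ k₁ → Σ ℕ λ k₂ → Walk (Adj T) c p k₁ × Walk (Adj T) q v k₂ × k₁ + suc k₂ ≡ m
    crossing cX vY [] = ⊥-elim (sides-disjoint cX vY)
    crossing {c} cX vY (_∷_ {v = c'} r w) with is-e? c c'
    ... | yes (inj₁ (refl , refl)) = 0 , _ , [] , w , refl
    ... | yes (inj₂ (refl , _)) = ⊥-elim (sides-disjoint cX (0 , []))
    ... | no ¬e with crossing (extend cX (r , ¬e)) vY w
    ...   | k₁ , k₂ , w₁ , w₂ , e = suc k₁ , k₂ , r ∷ w₁ , w₂ , cong suc e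

    d-across : ∀ {c v} → X c → Y v → d c v ≡ d c p + suc (d q v)
    d-across {c} {v} cX vY with crossing cX vY (geodesic-walk c v)
    ... | k₁ , k₂ , w₁ , w₂ , e = ≤-antisym
      (≤-trans (d-triangle c p v) (+-monoʳ-≤ (d c p) (d-adjacent v pq)))
      (subst (d c p + suc (d q v) ≤_) e (+-mono-≤ (d-minimal w₁) (s≤s (d-minimal w₂))))

    X? : ∀ u → Dec (X u)
    X? u with sides-cover u
    ... | inj₁ uX = yes uX
    ... | inj₂ uY = no λ uX → sides-disjoint uX uY

    Y? : ∀ u → Dec (Y u)
    Y? u with sides-cover u
    ... | inj₁ uX = no λ uY → sides-disjoint uX uY
    ... | inj₂ uY = yes uY

  module _ {x x' y : Fin n} (r : Adj T x x') (x'-toward-y : d x y ≡ suc (d x' y)) where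
    open Cut x x' r
    open ≤-Reasoning

    target-beyond : Y y
    target-beyond with sides-cover y
    ... | inj₂ yY = yY
    ... | inj₁ yX = ⊥-elim (m≢1+m+n (d x' y) (begin-equality
      d x' y                 ≡⟨ d-sym x' y ⟩
      d y x'                 ≡⟨ d-across yX (0 , []) ⟩
      d y x + suc (d x' x')  ≡⟨ cong₂ (λ m k → m + suc k) (d-sym y x) (d-refl x') ⟩
      d x y + 1              ≡⟨ cong (_+ 1) x'-toward-y ⟩
      suc (d x' y + 1)       ∎))

    geodesic-through-x : ∀ {z} → X z → d z y ≡ d z x + d x y
    geodesic-through-x zX = trans (d-across zX target-beyond) (cong (_ +_) (sym x'-toward-y))

    geodesic-through-x' : ∀ {z} → Y z → d x z ≡ suc (d x' z)
    geodesic-through-x' {z} zY = trans (d-across (0 , []) zY) (cong (_+ suc (d x' z)) (d-refl x))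

    four-point-near : ∀ {z} → X z → ∀ w → d x y + d z w ≤ d x w + d y z
    four-point-near {z} zX w = begin
      d x y + d z w            ≤⟨ +-monoʳ-≤ (d x y) (d-triangle z x w) ⟩
      d x y + (d z x + d x w)  ≡⟨ x∙yz≈yx∙z (d x y) (d z x) (d x w) ⟩
      (d z x + d x y) + d x w  ≡⟨ cong (_+ d x w) (sym (geodesic-through-x zX)) ⟩
      d z y + d x w            ≡⟨ +-comm (d z y) (d x w) ⟩
      d x w + d z y            ≡⟨ cong (d x w +_) (d-sym z y) ⟩
      d x w + d y z            ∎

    four-point-far : ∀ {z} → Y z → ∀ {m k} → d x' y + m ≤ d x' z + k → d x y + m ≤ d x z + k
    four-point-far zY {m} {k} le =
      subst₂ (λ a b → a + m ≤ b + k) (sym x'-toward-y) (sym (geodesic-through-x' zY)) (s≤s le)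

    four-point-step : FourPointAt d x' y → FourPointAt d x y
    four-point-step ih z w with sides-cover z | sides-cover w
    ... | inj₁ zX | _ = inj₂ (four-point-near zX w)
    ... | inj₂ _ | inj₁ wX =
      inj₁ (subst (λ m → d x y + m ≤ d x z + d y w) (d-sym w z) (four-point-near wX z))
    ... | inj₂ zY | inj₂ wY = ⊎-map (four-point-far zY) (four-point-far wY) (ih z w)

  four-point-diagonal : ∀ y → FourPointAt d y y
  four-point-diagonal y z w = inj₁ (begin
    d y y + d z w  ≡⟨ cong (_+ d z w) (d-refl y) ⟩
    d z w          ≤⟨ d-triangle z y w ⟩
    d z y + d y w  ≡⟨ cong (_+ d y w) (d-sym z y) ⟩
    d y z + d y w  ∎)
    where open ≤-Reasoning

  four-point : FourPoint d
  four-point x y = by-distance (d x y) refl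
    where
    by-distance : ∀ k {x} → d x y ≡ k → FourPointAt d x y
    by-distance zero e rewrite d≡0⇒≡ e = four-point-diagonal y
    by-distance (suc k) e with next-hop e
    ... | x' , r , e' = four-point-step r (trans e (cong suc (sym e'))) (by-distance k e')

  open PairMetric d d-sym four-point

  module _ (G : Graph n) {p q : Fin n} (pq : Adj T p q) where
    open Cut p q pq

    swap? : Decidable (Swap G T p q)
    swap? (u , v) = X? u ×-dec Y? v ×-dec G u v ≟ᵇ true ×-dec ¬? (u ≟ᶠ p ×-dec v ≟ᶠ q)

    critical-if-farthest : ∀ f c → (∀ g → Swap G T p q g → E f g ≤ E f c) → Critical G T p q f c
    critical-if-farthest (x , y) (a , b) farthest a' b' s _ _ _ _ D₁ D₂ D₁' D₂'
      rewrite Dist⇒≡d D₁ | Dist⇒≡d D₂ | Dist⇒≡d D₁' | Dist⇒≡d D₂' | d-sym b y | d-sym b' y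
      = subst₂ _≤_ (sym (+-suc-middle (d x a') (d y b'))) (sym (+-suc-middle (d x a) (d y b)))
               (s≤s (farthest (a' , b') s))
      where
      +-suc-middle : ∀ m k → m + 1 + k ≡ suc (m + k)
      +-suc-middle m k = trans (+-assoc m 1 k) (+-suc m k)

    critical-set : Σ (List (Fin n × Fin n)) λ C →
      length C ≤ 4 × (∀ g → g ∈ C → Swap G T p q g) ×
      (∀ f → Swap G T p q f → ∃ λ g → g ∈ C × Critical G T p q f g)
    critical-set with enumerate swap?
    ... | L , swap-sound , swap-complete with farthest-among-four L
    ...   | C , |C|≤4 , C⊆L , farthest =
      C , |C|≤4 , (λ g g∈C → swap-sound g (C⊆L g g∈C)) , critical
      where
      critical : ∀ f → Swap G T p q f → ∃ λ g → g ∈ C × Critical G T p q f g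
      critical f f-swap with farthest f (swap-complete f f-swap)
      ... | c , c∈C , c-farthest =
        c , c∈C , critical-if-farthest f c λ g g-swap → c-farthest g (swap-complete g g-swap)

theorem1 : (n : ℕ) (G T : Graph n) → SimpleGraph G → TwoEdgeConnected G →
    SpanningTree T G → (p q : Fin n) → Adj T p q →
    Σ (List (Fin n × Fin n)) λ C →
      (length C ≤ 6) × ((g : Fin n × Fin n) → g ∈ C → Swap G T p q g) ×
      ((f : Fin n × Fin n) → Swap G T p q f →
        ∃ λ g → (g ∈ C) × Critical G T p q f g)
theorem1 n G T _ _ (_ , (T-sym , _) , T-connected , T-bridge) p q pq
  with TreeMetric.critical-set T T-sym T-connected T-bridge G pq
... | C , |C|≤4 , C-swaps , C-critical = C , ≤-trans |C|≤4 (m≤m+n 4 2) , C-swaps , C-critical
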